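{- Let $k\ge 2$ and let $f^s_{k,n}$, $l^i_{k,n}$ ($1\le s,i\le k$, $n\in\mathbb{Z}$) be as in the context. Then for all integers $m,n$ and every $1\le i\le k-1$, $$l^i_{k,n+m}=\sum_{j=1}^{i}\Big(l^k_{k,m-j}\sum_{s=1}^{j}f^s_{k,n}\Big)+\sum_{j=i+1}^{k}\Big(l^k_{k,m-j}\sum_{s=j-i+1}^{j}f^s_{k,n}\Big)+\sum_{j=k+1}^{k+i-1}\Big(l^k_{k,m-j}\sum_{s=j-i+1}^{k}f^s_{k,n}\Big),$$ where a sum whose lower index exceeds its upper index is zero.
   Context: $k$ sequences of generalized order-$k$ Fibonacci numbers: for $1\le i\le k$, $f^i_{k,n}=1$ if $1-k\le n\le 0$ and $i=1-n$, $f^i_{k,n}=0$ if $1-k\le n\le 0$ and $i\neq 1-n$, and $f^i_{k,n}=\sum_{j=1}^k f^i_{k,n-j}$ for $n\ge 1$. $k$ sequences of generalized order-$k$ Lucas numbers: for $1\le i\le k$ and $1-k\le n\le 0$, $l^i_{k,n}=-i$ if $i-n<k$, $l^i_{k,n}=i-2n$ if $i-n=k$, $l^i_{k,n}=k-i-1$ if $i-n>k$; and $l^i_{k,n}=\sum_{j=1}^k l^i_{k,n-j}$ for $n\ge 1$. All these sequences are extended to all integers $n$ by requiring their recurrence $x_n=\sum_{j=1}^k x_{n-j}$ to hold for all $n\in\mathbb{Z}$. -}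

module Defs where

open import Data.Nat using (ℕ; zero; suc; _∸_) renaming (_≤_ to _≤ℕ_)
open import Data.Integer using (ℤ; +_; _+_; _-_; _*_; -_; _≤_; _<_; _>_)
open import Relation.Binary.PropositionalEquality using (_≡_; _≢_)
open import Data.Product using (_×_)

sumGo : ℕ → ℕ → (ℕ → ℤ) → ℤ
sumGo a zero    g = + 0
sumGo a (suc c) g = g a + sumGo (suc a) c g

-- Σ[ j = a .. b ] g j  ; equals 0 when a > b
Σ[_⋯_] : ℕ → ℕ → (ℕ → ℤ) → ℤ
Σ[ a ⋯ b ] g = sumGo a (suc b ∸ a) g

recSum : ℕ → (ℤ → ℤ) → ℤ → ℤ
recSum k x n = Σ[ 1 ⋯ k ] (λ j → x (n - + j))

-- f i n  stands for  f^i_{k,n}  (only 1 ≤ i ≤ k is meaningful)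
IsGenFib : ℕ → (ℕ → ℤ → ℤ) → Set
IsGenFib k f =
    (∀ i → 1 ≤ℕ i → i ≤ℕ k → ∀ (n : ℤ) → (+ 1 - + k) ≤ n → n ≤ + 0 →
       + i ≡ + 1 - n → f i n ≡ + 1)
  × (∀ i → 1 ≤ℕ i → i ≤ℕ k → ∀ (n : ℤ) → (+ 1 - + k) ≤ n → n ≤ + 0 →
       + i ≢ + 1 - n → f i n ≡ + 0)
  × (∀ i → 1 ≤ℕ i → i ≤ℕ k → ∀ (n : ℤ) → f i n ≡ recSum k (f i) n)

IsGenLucas : ℕ → (ℕ → ℤ → ℤ) → Set
IsGenLucas k l =
    (∀ i → 1 ≤ℕ i → i ≤ℕ k → ∀ (n : ℤ) → (+ 1 - + k) ≤ n → n ≤ + 0 →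
       + i - n < + k → l i n ≡ - (+ i))
  × (∀ i → 1 ≤ℕ i → i ≤ℕ k → ∀ (n : ℤ) → (+ 1 - + k) ≤ n → n ≤ + 0 →
       + i - n ≡ + k → l i n ≡ + i - (n + n))
  × (∀ i → 1 ≤ℕ i → i ≤ℕ k → ∀ (n : ℤ) → (+ 1 - + k) ≤ n → n ≤ + 0 →
       + i - n > + k → l i n ≡ + k - + i - + 1)
  × (∀ i → 1 ≤ℕ i → i ≤ℕ k → ∀ (n : ℤ) → l i n ≡ recSum k (l i) n)

module Submission where

--   (1) Fibonacci expansion.  Solutions of x_p = x_{p-1} + ... + x_{p-k} are
--       determined by k consecutive values, and f^1, ..., f^k is the basis
--       dual to the window p = 0, -1, ..., 1-k.  Hence every solution x obeys
--       x_{n+c} = Σ_{s=1}^{k} x_{c+1-s} f^s_n.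
--   (2) Lucas numbers as partial sums.  From the initial values one checks
--       l^1_{p+1} = l^k_p and l^{i+1}_{p+1} = l^i_p + l^k_p (i + 1 < k); by
--       induction  l^i_p = l^k_{p-1} + ... + l^k_{p-i}  for 1 ≤ i < k.
--   (3) A convolution identity: for g supported in [1, k],
--       Σ_{t<i} Σ_{s=1}^{k} a_{t+s} g_s = Σ_{j=1}^{k+i-1} a_j (g_j + ... + g_{j-i+1}),
--       and the inner window sums split into the three ranges of the statement.
--
-- The theorem follows: l^i_{n+m} = Σ_{t=1}^{i} l^k_{n+m-t} by (2), each term is
-- expanded by (1) with x = l^k, and (3) regroups the double sum.

open import Defs
open import Data.Nat using (ℕ; _≤_; _∸_) renaming (_+_ to _+ℕ_)
open import Data.Integer using (ℤ; +_; _+_; _-_; _*_)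
open import Relation.Binary.PropositionalEquality using (_≡_)

open import Data.Nat using (zero; suc; z≤n; s≤s; _<_; _≟_; _≤?_)
import Data.Nat.Properties as ℕP
open import Data.Integer using (-_; -[1+_]; +≤+; +<+)
import Data.Integer as Int
import Data.Integer.Properties as ℤP
open import Data.Integer.Tactic.RingSolver using (solve-∀)
open import Algebra.Properties.AbelianGroup ℤP.+-0-abelianGroup using (∙-cancelˡ)
open import Data.Product using (_,_; proj₁; proj₂)
open import Data.Sum using (inj₁; inj₂)
open import Data.Empty using (⊥-elim)
open import Relation.Binary.Definitions using (tri<; tri≈; tri>)
open import Relation.Binary.PropositionalEquality
  using (refl; sym; trans; cong; cong₂; subst; _≢_; module ≡-Reasoning)
open import Relation.Nullary using (yes; no)

open ≡-Reasoning

head-in-range : ∀ a c → a < a +ℕ suc c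
head-in-range a c = ℕP.m<m+n a (s≤s z≤n)

tail-in-range : ∀ {a c j} → j < suc a +ℕ c → j < a +ℕ suc c
tail-in-range {a} {c} {j} = subst (j <_) (sym (ℕP.+-suc a c))

sumGo-cong : ∀ a c {g h : ℕ → ℤ} → (∀ j → a ≤ j → j < a +ℕ c → g j ≡ h j) →
             sumGo a c g ≡ sumGo a c h
sumGo-cong a zero    eq = refl
sumGo-cong a (suc c) eq =
  cong₂ _+_ (eq a ℕP.≤-refl (head-in-range a c))
            (sumGo-cong (suc a) c (λ j a<j j<e → eq j (ℕP.<⇒≤ a<j) (tail-in-range j<e)))

sumGo-vanish : ∀ a c {g : ℕ → ℤ} → (∀ j → a ≤ j → j < a +ℕ c → g j ≡ + 0) → sumGo a c g ≡ + 0
sumGo-vanish a zero    z = refl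
sumGo-vanish a (suc c) z =
  cong₂ _+_ (z a ℕP.≤-refl (head-in-range a c))
            (sumGo-vanish (suc a) c (λ j a<j j<e → z j (ℕP.<⇒≤ a<j) (tail-in-range j<e)))

sumGo-+ : ∀ a c (g h : ℕ → ℤ) → sumGo a c (λ j → g j + h j) ≡ sumGo a c g + sumGo a c h
sumGo-+ a zero    g h = refl
sumGo-+ a (suc c) g h =
  trans (cong (_+_ (g a + h a)) (sumGo-+ (suc a) c g h)) (interchange (g a) (h a) _ _)
  where
  interchange : ∀ (w x y z : ℤ) → w + x + (y + z) ≡ w + y + (x + z)
  interchange = solve-∀

sumGo-*ˡ : ∀ a c (x : ℤ) (g : ℕ → ℤ) → sumGo a c (λ j → x * g j) ≡ x * sumGo a c g
sumGo-*ˡ a zero    x g = sym (ℤP.*-zeroʳ x)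
sumGo-*ˡ a (suc c) x g =
  trans (cong (_+_ (x * g a)) (sumGo-*ˡ (suc a) c x g)) (sym (ℤP.*-distribˡ-+ x (g a) _))

sumGo-swap : ∀ a c b d (F : ℕ → ℕ → ℤ) →
  sumGo a c (λ j → sumGo b d (F j)) ≡ sumGo b d (λ s → sumGo a c (λ j → F j s))
sumGo-swap a zero    b d F = sym (sumGo-vanish b d (λ _ _ _ → refl))
sumGo-swap a (suc c) b d F =
  trans (cong (_+_ (sumGo b d (F a))) (sumGo-swap (suc a) c b d F))
        (sym (sumGo-+ b d (F a) (λ s → sumGo (suc a) c (λ j → F j s))))

sumGo-split : ∀ a c d (g : ℕ → ℤ) → sumGo a (c +ℕ d) g ≡ sumGo a c g + sumGo (a +ℕ c) d g
sumGo-split a zero    d g =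
  trans (cong (λ t → sumGo t d g) (sym (ℕP.+-identityʳ a))) (sym (ℤP.+-identityˡ _))
sumGo-split a (suc c) d g =
  trans (cong (_+_ (g a)) (trans (sumGo-split (suc a) c d g)
                              (cong (λ t → sumGo (suc a) c g + sumGo t d g) (sym (ℕP.+-suc a c)))))
        (sym (ℤP.+-assoc (g a) _ _))

sumGo-snoc : ∀ a c (g : ℕ → ℤ) → sumGo a (suc c) g ≡ sumGo a c g + g (a +ℕ c)
sumGo-snoc a c g =
  trans (cong (λ t → sumGo a t g) (ℕP.+-comm 1 c))
        (trans (sumGo-split a c 1 g) (cong (_+_ (sumGo a c g)) (ℤP.+-identityʳ _)))

sumGo-shift : ∀ a c (g : ℕ → ℤ) → sumGo (suc a) c g ≡ sumGo a c (λ j → g (suc j))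
sumGo-shift a zero    g = refl
sumGo-shift a (suc c) g = cong (_+_ (g (suc a))) (sumGo-shift (suc a) c g)

sumGo-const : ∀ a c (v : ℤ) → sumGo a c (λ _ → v) ≡ + c * v
sumGo-const a zero    v = sym (ℤP.*-zeroˡ v)
sumGo-const a (suc c) v = trans (cong (_+_ v) (sumGo-const (suc a) c v)) (one-more (+ c) v)
  where
  one-more : ∀ (x v : ℤ) → v + x * v ≡ (+ 1 + x) * v
  one-more = solve-∀

sumGo-delta : ∀ a c (g : ℕ → ℤ) s0 → a ≤ s0 → s0 < a +ℕ c →
  (∀ j → a ≤ j → j < a +ℕ c → j ≢ s0 → g j ≡ + 0) → sumGo a c g ≡ g s0
sumGo-delta a zero g s0 a≤s0 s0< _ =
  ⊥-elim (ℕP.<-irrefl refl (ℕP.≤-<-trans a≤s0 (subst (s0 <_) (ℕP.+-identityʳ a) s0<)))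
sumGo-delta a (suc c) g s0 a≤s0 s0< z with a ≟ s0
... | yes refl =
  trans (cong (_+_ (g a)) (sumGo-vanish (suc a) c
          (λ j a<j j<e → z j (ℕP.<⇒≤ a<j) (tail-in-range j<e) (λ j≡a → ℕP.<-irrefl (sym j≡a) a<j))))
        (ℤP.+-identityʳ _)
... | no a≢s0 =
  trans (cong (_+ sumGo (suc a) c g) (z a ℕP.≤-refl (head-in-range a c) a≢s0))
        (trans (ℤP.+-identityˡ _) (sumGo-delta (suc a) c g s0 (ℕP.≤∧≢⇒< a≤s0 a≢s0) (subst (s0 <_) (ℕP.+-suc a c) s0<)
          (λ j a<j j<e → z j (ℕP.<⇒≤ a<j) (tail-in-range j<e))))

Σ-cong : ∀ a b {g h : ℕ → ℤ} → (∀ s → a ≤ s → s ≤ b → g s ≡ h s) → Σ[ a ⋯ b ] g ≡ Σ[ a ⋯ b ] h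
Σ-cong a b eq = sumGo-cong a (suc b ∸ a) (λ s a≤s s<e → eq s a≤s (ℕP.≤-pred (below-end a≤s s<e)))
  where
  below-end : ∀ {s} → a ≤ s → s < a +ℕ (suc b ∸ a) → s < suc b
  below-end {s} a≤s s<e with a ≤? suc b
  ... | yes a≤ = subst (s <_) (ℕP.m+[n∸m]≡n a≤) s<e
  ... | no a≰ = ⊥-elim (ℕP.<-irrefl refl (ℕP.≤-<-trans a≤s
                  (subst (s <_) (trans (cong (a +ℕ_) (ℕP.m≤n⇒m∸n≡0 (ℕP.<⇒≤ (ℕP.≰⇒> a≰))))
                                       (ℕP.+-identityʳ a)) s<e)))

Σ-snoc : ∀ a b (g : ℕ → ℤ) → a ≤ suc b → Σ[ a ⋯ suc b ] g ≡ Σ[ a ⋯ b ] g + g (suc b)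
Σ-snoc a b g a≤ =
  trans (cong (λ t → sumGo a t g) (ℕP.+-∸-assoc 1 a≤))
        (trans (sumGo-snoc a (suc b ∸ a) g) (cong (λ t → Σ[ a ⋯ b ] g + g t) (ℕP.m+[n∸m]≡n a≤)))

Σ-pad : ∀ b k d (h : ℕ → ℤ) → b ≤ suc k → (∀ s → k < s → h s ≡ + 0) →
        Σ[ b ⋯ k ] h ≡ Σ[ b ⋯ k +ℕ d ] h
Σ-pad b k zero    h b≤ z = cong (λ t → Σ[ b ⋯ t ] h) (sym (ℕP.+-identityʳ k))
Σ-pad b k (suc d) h b≤ z = begin
  Σ[ b ⋯ k ] h                          ≡⟨ Σ-pad b k d h b≤ z ⟩
  Σ[ b ⋯ k +ℕ d ] h                     ≡⟨ sym (ℤP.+-identityʳ _) ⟩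
  Σ[ b ⋯ k +ℕ d ] h + + 0               ≡⟨ cong (_+_ (Σ[ b ⋯ k +ℕ d ] h)) (sym (z _ (s≤s (ℕP.m≤m+n k d)))) ⟩
  Σ[ b ⋯ k +ℕ d ] h + h (suc (k +ℕ d))  ≡⟨ sym (Σ-snoc b (k +ℕ d) h (ℕP.≤-trans b≤ (s≤s (ℕP.m≤m+n k d)))) ⟩
  Σ[ b ⋯ suc (k +ℕ d) ] h               ≡⟨ cong (λ t → Σ[ b ⋯ t ] h) (sym (ℕP.+-suc k d)) ⟩
  Σ[ b ⋯ k +ℕ suc d ] h                 ∎

window : ℕ → ℕ → (ℕ → ℤ) → ℤ
window zero    j       g = + 0
window (suc i) zero    g = + 0
window (suc i) (suc j) g = g (suc j) + window i j g

Σ-window : ∀ i j (g : ℕ → ℤ) → Σ[ j ∸ i +ℕ 1 ⋯ j ] g ≡ window i j g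
Σ-window zero    j       g =
  cong (λ t → sumGo (j +ℕ 1) t g) (trans (cong (suc j ∸_) (ℕP.+-comm j 1)) (ℕP.n∸n≡0 j))
Σ-window (suc i) zero    g = refl
Σ-window (suc i) (suc j) g =
  trans (Σ-snoc (j ∸ i +ℕ 1) j g (subst (_≤ suc j) (ℕP.+-comm 1 (j ∸ i)) (s≤s (ℕP.m∸n≤m j i))))
        (trans (cong (_+ g (suc j)) (Σ-window i j g)) (ℤP.+-comm (window i j g) (g (suc j))))

truncate : ℕ → (ℕ → ℤ) → ℕ → ℤ
truncate k F s with s ≤? k
... | yes _ = F s
... | no  _ = + 0

truncate-≤ : ∀ k F s → s ≤ k → truncate k F s ≡ F s
truncate-≤ k F s s≤k with s ≤? k
... | yes _   = refl
... | no  s≰k = ⊥-elim (s≰k s≤k)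

truncate-> : ∀ k F s → k < s → truncate k F s ≡ + 0
truncate-> k F s k<s with s ≤? k
... | yes s≤k = ⊥-elim (ℕP.<⇒≱ k<s s≤k)
... | no  _   = refl

sumGo-supported : ∀ k t (h : ℕ → ℤ) → (∀ j → k < j → h j ≡ + 0) → sumGo 1 (k +ℕ t) h ≡ sumGo 1 k h
sumGo-supported k t h z =
  trans (sumGo-split 1 k t h)
        (trans (cong (_+_ (sumGo 1 k h)) (sumGo-vanish (suc k) t (λ j k<j _ → z j k<j))) (ℤP.+-identityʳ _))

*-supported : ∀ k (a g : ℕ → ℤ) → (∀ s → k < s → g s ≡ + 0) → ∀ j → k < j → a j * g j ≡ + 0
*-supported k a g z j k<j = trans (cong (a j *_) (z j k<j)) (ℤP.*-zeroʳ (a j))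

-- Induction on i' peels off the row t = 0 and shifts a by one.
convolution : ∀ k (g : ℕ → ℤ) → (∀ s → k < s → g s ≡ + 0) → ∀ i' (a : ℕ → ℤ) →
  sumGo 0 (suc i') (λ t → sumGo 1 k (λ s → a (t +ℕ s) * g s))
  ≡ sumGo 1 (k +ℕ i') (λ j → a j * window (suc i') j g)
convolution k g z zero a = begin
  sumGo 1 k ag + + 0                             ≡⟨ ℤP.+-identityʳ _ ⟩
  sumGo 1 k ag                                   ≡⟨ sym (sumGo-supported k 0 ag (*-supported k a g z)) ⟩
  sumGo 1 (k +ℕ 0) ag                            ≡⟨ sumGo-cong 1 (k +ℕ 0) (λ { (suc j) _ _ →
                                                      cong (a (suc j) *_) (sym (ℤP.+-identityʳ _)) }) ⟩
  sumGo 1 (k +ℕ 0) (λ j → a j * window 1 j g)    ∎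
  where
  ag : ℕ → ℤ
  ag j = a j * g j
convolution k g z (suc i') a = begin
  sumGo 1 k ag + sumGo 1 (suc i') rows
    ≡⟨ cong (_+_ (sumGo 1 k ag)) (trans (sumGo-shift 0 (suc i') rows) (convolution k g z i' (λ j → a (suc j)))) ⟩
  sumGo 1 k ag + sumGo 1 (k +ℕ i') (λ j → a (suc j) * window (suc i') j g)
    ≡⟨ cong (_+ W) (sym (sumGo-supported k (suc i') ag (*-supported k a g z))) ⟩
  sumGo 1 (k +ℕ suc i') ag + W
    ≡⟨ cong (λ c → sumGo 1 c ag + W) (ℕP.+-suc k i') ⟩
  sumGo 1 (suc (k +ℕ i')) ag + W
    ≡⟨ regroup ⟩
  sumGo 1 (suc (k +ℕ i')) (λ j → a j * window (suc (suc i')) j g)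
    ≡⟨ cong (λ c → sumGo 1 c (λ j → a j * window (suc (suc i')) j g)) (sym (ℕP.+-suc k i')) ⟩
  sumGo 1 (k +ℕ suc i') (λ j → a j * window (suc (suc i')) j g) ∎
  where
  ag : ℕ → ℤ
  ag j = a j * g j
  rows : ℕ → ℤ
  rows t = sumGo 1 k (λ s → a (t +ℕ s) * g s)
  W : ℤ
  W = sumGo 1 (k +ℕ i') (λ j → a (suc j) * window (suc i') j g)
  -- window (i'+2) j g = g j + window (i'+1) (j-1) g, and the first term is a_1 g_1.
  regroup : sumGo 1 (suc (k +ℕ i')) ag + W
          ≡ sumGo 1 (suc (k +ℕ i')) (λ j → a j * window (suc (suc i')) j g)
  regroup = begin
    a 1 * g 1 + sumGo 2 (k +ℕ i') ag + W
      ≡⟨ cong (λ S → a 1 * g 1 + S + W) (sumGo-shift 1 (k +ℕ i') ag) ⟩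
    a 1 * g 1 + sumGo 1 (k +ℕ i') (λ j → ag (suc j)) + W
      ≡⟨ ℤP.+-assoc (a 1 * g 1) _ W ⟩
    a 1 * g 1 + (sumGo 1 (k +ℕ i') (λ j → ag (suc j)) + W)
      ≡⟨ cong₂ _+_ (cong (a 1 *_) (sym (ℤP.+-identityʳ (g 1))))
                   (sym (sumGo-+ 1 (k +ℕ i') (λ j → ag (suc j)) (λ j → a (suc j) * window (suc i') j g))) ⟩
    a 1 * (g 1 + + 0) + sumGo 1 (k +ℕ i') (λ j → ag (suc j) + a (suc j) * window (suc i') j g)
      ≡⟨ cong (_+_ (a 1 * (g 1 + + 0))) (sumGo-cong 1 (k +ℕ i')
           (λ j _ _ → sym (ℤP.*-distribˡ-+ (a (suc j)) (g (suc j)) (window (suc i') j g)))) ⟩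
    a 1 * (g 1 + + 0) + sumGo 1 (k +ℕ i') (λ j → a (suc j) * window (suc (suc i')) (suc j) g)
      ≡⟨ cong (_+_ (a 1 * (g 1 + + 0))) (sym (sumGo-shift 1 (k +ℕ i') (λ j → a j * window (suc (suc i')) j g))) ⟩
    sumGo 1 (suc (k +ℕ i')) (λ j → a j * window (suc (suc i')) j g) ∎

-- The three ranges of the statement are one window sum over [1, k + i - 1]
-- once the inner sums are read in the zero-extension g = truncate k F.
three-ranges : ∀ k i' (a F : ℕ → ℤ) → suc i' ≤ k →
    Σ[ 1 ⋯ suc i' ] (λ j → a j * Σ[ 1 ⋯ j ] F)
    + Σ[ suc i' +ℕ 1 ⋯ k ] (λ j → a j * Σ[ j ∸ suc i' +ℕ 1 ⋯ j ] F)
    + Σ[ k +ℕ 1 ⋯ k +ℕ suc i' ∸ 1 ] (λ j → a j * Σ[ j ∸ suc i' +ℕ 1 ⋯ k ] F)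
  ≡ sumGo 1 (k +ℕ i') (λ j → a j * window (suc i') j (truncate k F))
three-ranges k i' a F i≤k = begin
  sumGo 1 i low + Σ[ i +ℕ 1 ⋯ k ] mid + Σ[ k +ℕ 1 ⋯ k +ℕ i ∸ 1 ] high
    ≡⟨ cong₂ _+_ (cong₂ _+_ low-range mid-range) high-range ⟩
  sumGo 1 i H + sumGo (suc i) (k ∸ i) H + sumGo (suc k) i' H
    ≡⟨ cong (_+ sumGo (suc k) i' H) (sym (sumGo-split 1 i (k ∸ i) H)) ⟩
  sumGo 1 (i +ℕ (k ∸ i)) H + sumGo (suc k) i' H
    ≡⟨ cong (λ c → sumGo 1 c H + sumGo (suc k) i' H) (ℕP.m+[n∸m]≡n i≤k) ⟩
  sumGo 1 k H + sumGo (suc k) i' H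
    ≡⟨ sym (sumGo-split 1 k i' H) ⟩
  sumGo 1 (k +ℕ i') H ∎
  where
  i : ℕ
  i = suc i'
  g H low mid high : ℕ → ℤ
  g = truncate k F
  H j = a j * window i j g
  low j = a j * Σ[ 1 ⋯ j ] F
  mid j = a j * Σ[ j ∸ i +ℕ 1 ⋯ j ] F
  high j = a j * Σ[ j ∸ i +ℕ 1 ⋯ k ] F

  inner-mid : ∀ j → j ≤ k → Σ[ j ∸ i +ℕ 1 ⋯ j ] F ≡ window i j g
  inner-mid j j≤k =
    trans (Σ-cong (j ∸ i +ℕ 1) j (λ s _ s≤j → sym (truncate-≤ k F s (ℕP.≤-trans s≤j j≤k))))
          (Σ-window i j g)

  inner-low : ∀ j → j ≤ i → Σ[ 1 ⋯ j ] F ≡ window i j g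
  inner-low j j≤i =
    trans (cong (λ b → Σ[ b +ℕ 1 ⋯ j ] F) (sym (ℕP.m≤n⇒m∸n≡0 j≤i)))
          (inner-mid j (ℕP.≤-trans j≤i i≤k))

  -- Beyond k, g vanishes, so the inner sum may run up to j.
  inner-high : ∀ j → k < j → j ≤ k +ℕ i' → Σ[ j ∸ i +ℕ 1 ⋯ k ] F ≡ window i j g
  inner-high j k<j j≤ = begin
    Σ[ j ∸ i +ℕ 1 ⋯ k ] F            ≡⟨ Σ-cong (j ∸ i +ℕ 1) k (λ s _ s≤k → sym (truncate-≤ k F s s≤k)) ⟩
    Σ[ j ∸ i +ℕ 1 ⋯ k ] g            ≡⟨ Σ-pad (j ∸ i +ℕ 1) k (j ∸ k) g start≤ (truncate-> k F) ⟩
    Σ[ j ∸ i +ℕ 1 ⋯ k +ℕ (j ∸ k) ] g ≡⟨ cong (λ t → Σ[ j ∸ i +ℕ 1 ⋯ t ] g) (ℕP.m+[n∸m]≡n (ℕP.<⇒≤ k<j)) ⟩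
    Σ[ j ∸ i +ℕ 1 ⋯ j ] g            ≡⟨ Σ-window i j g ⟩
    window i j g                     ∎
    where
    j≤i+k : j ≤ i +ℕ k
    j≤i+k = subst (j ≤_) (ℕP.+-comm k i) (ℕP.≤-trans j≤ (ℕP.+-monoʳ-≤ k (ℕP.n≤1+n i')))
    start≤ : j ∸ i +ℕ 1 ≤ suc k
    start≤ = subst (_≤ suc k) (ℕP.+-comm 1 (j ∸ i)) (s≤s (ℕP.m≤n+o⇒m∸n≤o j i j≤i+k))

  low-range : sumGo 1 i low ≡ sumGo 1 i H
  low-range = sumGo-cong 1 i (λ j _ j<e → cong (a j *_) (inner-low j (ℕP.≤-pred j<e)))

  mid-range : Σ[ i +ℕ 1 ⋯ k ] mid ≡ sumGo (suc i) (k ∸ i) H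
  mid-range =
    trans (cong (λ b → sumGo b (suc k ∸ b) mid) (ℕP.+-comm i 1))
          (sumGo-cong (suc i) (k ∸ i) (λ j _ j<e → cong (a j *_)
             (inner-mid j (ℕP.≤-pred (subst (j <_) (cong suc (ℕP.m+[n∸m]≡n i≤k)) j<e)))))

  high-count : suc (k +ℕ i ∸ 1) ∸ (k +ℕ 1) ≡ i'
  high-count =
    trans (cong₂ _∸_ (cong (λ t → suc (t ∸ 1)) (ℕP.+-suc k i')) (ℕP.+-comm k 1)) (ℕP.m+n∸m≡n k i')

  high-range : Σ[ k +ℕ 1 ⋯ k +ℕ i ∸ 1 ] high ≡ sumGo (suc k) i' H
  high-range =
    trans (cong₂ (λ b c → sumGo b c high) (ℕP.+-comm k 1) high-count)
          (sumGo-cong (suc k) i' (λ j k<j j<e → cong (a j *_) (inner-high j k<j (ℕP.≤-pred j<e))))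

Rec : ℕ → (ℤ → ℤ) → Set
Rec k x = ∀ p → x p ≡ recSum k x p

Rec-shift : ∀ k x → Rec k x → ∀ c → Rec k (λ p → x (p + c))
Rec-shift k x rx c p = trans (rx (p + c)) (sumGo-cong 1 k (λ j _ _ → cong x (reorder p c (+ j))))
  where
  reorder : ∀ (p c j : ℤ) → p + c - j ≡ p - j + c
  reorder = solve-∀

Rec-+ : ∀ k x y → Rec k x → Rec k y → Rec k (λ p → x p + y p)
Rec-+ k x y rx ry p = trans (cong₂ _+_ (rx p) (ry p)) (sym (sumGo-+ 1 k _ _))

Rec-lincomb : ∀ k a c (coeff : ℕ → ℤ) (F : ℕ → ℤ → ℤ) →
  (∀ s → a ≤ s → s < a +ℕ c → Rec k (F s)) → Rec k (λ p → sumGo a c (λ s → coeff s * F s p))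
Rec-lincomb k a c coeff F rF p = begin
  sumGo a c (λ s → coeff s * F s p)
    ≡⟨ sumGo-cong a c (λ s a≤s s<e →
         trans (cong (coeff s *_) (rF s a≤s s<e p)) (sym (sumGo-*ˡ 1 k (coeff s) (λ j → F s (p - + j))))) ⟩
  sumGo a c (λ s → sumGo 1 k (λ j → coeff s * F s (p - + j)))
    ≡⟨ sumGo-swap a c 1 k (λ s j → coeff s * F s (p - + j)) ⟩
  sumGo 1 k (λ j → sumGo a c (λ s → coeff s * F s (p - + j))) ∎

-- A solution of an order-k recurrence (k ≥ 1) is determined by its values at
-- 0, -1, ..., 1-k: agreement on one window of k consecutive integers propagates
-- one step up (by the recurrence) and one step down (solving for x_{p-k}).
uniqueness : ∀ k' {x y : ℤ → ℤ} → Rec (suc k') x → Rec (suc k') y →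
  (∀ d → d < suc k' → x (- + d) ≡ y (- + d)) → ∀ p → x p ≡ y p
uniqueness k' {x} {y} rx ry initial p =
  trans (cong x (sym (ℤP.+-identityʳ p))) (trans (agree p 0 (s≤s z≤n)) (cong y (ℤP.+-identityʳ p)))
  where
  k : ℕ
  k = suc k'

  back : ∀ (p d : ℤ) → + 1 + p - (+ 1 + d) ≡ p - d
  back = solve-∀

  down : ∀ (p d : ℤ) → -[1+ 0 ] + p - d ≡ p - (+ 1 + d)
  down = solve-∀

  AgreeBelow : ℤ → Set
  AgreeBelow p = ∀ d → d < k → x (p - + d) ≡ y (p - + d)

  agree-up : ∀ p → AgreeBelow p → AgreeBelow (+ 1 + p)
  agree-up p w zero    _ =
    trans (cong x (ℤP.+-identityʳ (+ 1 + p)))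
          (trans (trans (rx (+ 1 + p)) (trans (sumGo-cong 1 k step) (sym (ry (+ 1 + p)))))
                 (cong y (sym (ℤP.+-identityʳ (+ 1 + p)))))
    where
    step : ∀ j → 1 ≤ j → j < 1 +ℕ k → x (+ 1 + p - + j) ≡ y (+ 1 + p - + j)
    step (suc d) _ (s≤s d<k) = trans (cong x (back p (+ d))) (trans (w d d<k) (cong y (sym (back p (+ d)))))
  agree-up p w (suc d) d+1<k =
    trans (cong x (back p (+ d))) (trans (w d (ℕP.<⇒≤ d+1<k)) (cong y (sym (back p (+ d)))))

  agree-down : ∀ p → AgreeBelow p → AgreeBelow (-[1+ 0 ] + p)
  agree-down p w d d<k with ℕP.m≤n⇒m<n∨m≡n (ℕP.≤-pred d<k)
  ... | inj₁ d<k' = trans (cong x (down p (+ d))) (trans (w (suc d) (s≤s d<k')) (cong y (sym (down p (+ d)))))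
  ... | inj₂ refl = trans (cong x (down p (+ k'))) (trans oldest (cong y (sym (down p (+ k')))))
    where
    split : ∀ z → Rec k z → z p ≡ sumGo 1 k' (λ j → z (p - + j)) + z (p - + k)
    split z rz = trans (rz p) (sumGo-snoc 1 k' (λ j → z (p - + j)))
    newer : sumGo 1 k' (λ j → x (p - + j)) ≡ sumGo 1 k' (λ j → y (p - + j))
    newer = sumGo-cong 1 k' (λ j _ j<e → w j j<e)
    oldest : x (p - + k) ≡ y (p - + k)
    oldest = ∙-cancelˡ (sumGo 1 k' (λ j → x (p - + j))) (x (p - + k)) (y (p - + k)) (begin
      sumGo 1 k' (λ j → x (p - + j)) + x (p - + k) ≡⟨ sym (split x rx) ⟩
      x p                                          ≡⟨ cong x (sym (ℤP.+-identityʳ p)) ⟩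
      x (p - + 0)                                  ≡⟨ w 0 (s≤s z≤n) ⟩
      y (p - + 0)                                  ≡⟨ cong y (ℤP.+-identityʳ p) ⟩
      y p                                          ≡⟨ split y ry ⟩
      sumGo 1 k' (λ j → y (p - + j)) + y (p - + k) ≡⟨ cong (_+ y (p - + k)) (sym newer) ⟩
      sumGo 1 k' (λ j → x (p - + j)) + y (p - + k) ∎)

  agree-nonneg : ∀ n → AgreeBelow (+ n)
  agree-nonneg zero    d d<k = trans (cong x (ℤP.+-identityˡ (- + d)))
                                     (trans (initial d d<k) (cong y (sym (ℤP.+-identityˡ (- + d)))))
  agree-nonneg (suc n) = agree-up (+ n) (agree-nonneg n)

  agree-neg : ∀ n → AgreeBelow -[1+ n ]
  agree-neg zero    = agree-down (+ 0) (agree-nonneg 0)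
  agree-neg (suc n) = agree-down -[1+ n ] (agree-neg n)

  agree : ∀ p → AgreeBelow p
  agree (+ n)     = agree-nonneg n
  agree -[1+ n ]  = agree-neg n

module GeneralizedFibonacciLucas (k' : ℕ) (f l : ℕ → ℤ → ℤ)
                                 (hf : IsGenFib (suc k') f) (hl : IsGenLucas (suc k') l) where
  k : ℕ
  k = suc k'

  initial-lower : ∀ {d} → d < k → + 1 - + k Int.≤ - + d
  initial-lower {d} (s≤s d≤k') =
    subst (Int._≤ - + d) (sym (one-minus (+ k'))) (ℤP.neg-mono-≤ (+≤+ d≤k'))
    where
    one-minus : ∀ (x : ℤ) → + 1 - (+ 1 + x) ≡ - x
    one-minus = solve-∀

  initial-upper : ∀ d → - + d Int.≤ + 0
  initial-upper d = ℤP.neg-≤-pos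

  -- Rewrites the index expression i - n of the definitions at n = -d.
  minus-neg : ∀ (x y : ℤ) → x + y ≡ x - - y
  minus-neg = solve-∀

  fib-rec : ∀ s → 1 ≤ s → s ≤ k → Rec k (f s)
  fib-rec = proj₂ (proj₂ hf)

  lucas-rec : ∀ i → 1 ≤ i → i ≤ k → Rec k (l i)
  lucas-rec = proj₂ (proj₂ (proj₂ hl))

  fib-initial-one : ∀ d → d < k → f (suc d) (- + d) ≡ + 1
  fib-initial-one d d<k =
    proj₁ hf (suc d) (s≤s z≤n) d<k (- + d) (initial-lower d<k) (initial-upper d) (minus-neg (+ 1) (+ d))

  fib-initial-zero : ∀ s d → 1 ≤ s → s ≤ k → d < k → s ≢ suc d → f s (- + d) ≡ + 0
  fib-initial-zero s d 1≤s s≤k d<k s≢ =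
    proj₁ (proj₂ hf) s 1≤s s≤k (- + d) (initial-lower d<k) (initial-upper d)
          (λ eq → s≢ (ℤP.+-injective (trans eq (sym (minus-neg (+ 1) (+ d))))))

  fib-expansion : ∀ x → Rec k x → ∀ c n → x (n + c) ≡ sumGo 1 k (λ s → x (c + + 1 - + s) * f s n)
  fib-expansion x rx c =
    uniqueness k' (Rec-shift k x rx c)
      (Rec-lincomb k 1 k (λ s → x (c + + 1 - + s)) f (λ s 1≤s s<e → fib-rec s 1≤s (ℕP.≤-pred s<e)))
      initial
    where
    back : ∀ (c d : ℤ) → c + + 1 - (+ 1 + d) ≡ - d + c
    back = solve-∀
    initial : ∀ d → d < k → x (- + d + c) ≡ sumGo 1 k (λ s → x (c + + 1 - + s) * f s (- + d))
    initial d d<k = sym (begin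
      sumGo 1 k (λ s → x (c + + 1 - + s) * f s (- + d))
        ≡⟨ sumGo-delta 1 k _ (suc d) (s≤s z≤n) (s≤s d<k) (λ s 1≤s s<e s≢ →
             trans (cong (x (c + + 1 - + s) *_) (fib-initial-zero s d 1≤s (ℕP.≤-pred s<e) d<k s≢))
                   (ℤP.*-zeroʳ (x (c + + 1 - + s)))) ⟩
      x (c + + 1 - + suc d) * f (suc d) (- + d) ≡⟨ cong (x (c + + 1 - + suc d) *_) (fib-initial-one d d<k) ⟩
      x (c + + 1 - + suc d) * + 1               ≡⟨ ℤP.*-identityʳ _ ⟩
      x (c + + 1 - + suc d)                     ≡⟨ cong x (back c (+ d)) ⟩
      x (- + d + c)                             ∎)

  -- The initial value l^i_{-d} depends only on i and t = i + d.
  lucasInit : ℕ → ℕ → ℤ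
  lucasInit i t with ℕP.<-cmp t k
  ... | tri< _ _ _ = - + i
  ... | tri≈ _ _ _ = + k + + k - + i
  ... | tri> _ _ _ = + k - + i - + 1

  lucas-initial : ∀ i d → 1 ≤ i → i ≤ k → d < k → l i (- + d) ≡ lucasInit i (i +ℕ d)
  lucas-initial i d 1≤i i≤k d<k with ℕP.<-cmp (i +ℕ d) k
  ... | tri< lt _ _ = proj₁ hl i 1≤i i≤k (- + d) (initial-lower d<k) (initial-upper d)
                        (subst (Int._< + k) (minus-neg (+ i) (+ d)) (+<+ lt))
  ... | tri≈ _ eq _ = trans (proj₁ (proj₂ hl) i 1≤i i≤k (- + d) (initial-lower d<k) (initial-upper d)
                               (trans (sym (minus-neg (+ i) (+ d))) (cong +_ eq)))
                            (trans (twice (+ i) (+ d)) (cong (λ t → + t + + t - + i) eq))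
    where
    twice : ∀ (i d : ℤ) → i - (- d + - d) ≡ i + d + (i + d) - i
    twice = solve-∀
  ... | tri> _ _ gt = proj₁ (proj₂ (proj₂ hl)) i 1≤i i≤k (- + d) (initial-lower d<k) (initial-upper d)
                        (subst (+ k Int.<_) (minus-neg (+ i) (+ d)) (+<+ gt))

  lucasInit-below : ∀ i t → t < k → lucasInit i t ≡ - + i
  lucasInit-below i t t<k with ℕP.<-cmp t k
  ... | tri< _ _ _    = refl
  ... | tri≈ ¬lt _ _  = ⊥-elim (¬lt t<k)
  ... | tri> ¬lt _ _  = ⊥-elim (¬lt t<k)

  lucasInit-at : ∀ i t → t ≡ k → lucasInit i t ≡ + k + + k - + i
  lucasInit-at i t t≡k with ℕP.<-cmp t k
  ... | tri< _ ¬eq _  = ⊥-elim (¬eq t≡k)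
  ... | tri≈ _ _ _    = refl
  ... | tri> _ ¬eq _  = ⊥-elim (¬eq t≡k)

  lucasInit-above : ∀ i t → k < t → lucasInit i t ≡ + k - + i - + 1
  lucasInit-above i t k<t with ℕP.<-cmp t k
  ... | tri< _ _ ¬gt  = ⊥-elim (¬gt k<t)
  ... | tri≈ _ _ ¬gt  = ⊥-elim (¬gt k<t)
  ... | tri> _ _ _    = refl

  -- Raising i by one lowers every initial value by one: the window form of the
  -- step relation l^{i+1}_{p+1} = l^i_p + l^k_p (note l^k_{-d} = -1 for d ≥ 1).
  lucasInit-pred : ∀ i t → lucasInit (suc i) t ≡ lucasInit i t - + 1
  lucasInit-pred i t with ℕP.<-cmp t k
  ... | tri< _ _ _ = neg-suc (+ i)
    where
    neg-suc : ∀ (i : ℤ) → - (+ 1 + i) ≡ - i - + 1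
    neg-suc = solve-∀
  ... | tri≈ _ _ _ = minus-suc (+ k + + k) (+ i)
    where
    minus-suc : ∀ (a i : ℤ) → a - (+ 1 + i) ≡ a - i - + 1
    minus-suc = solve-∀
  ... | tri> _ _ _ = minus-suc (+ k) (+ i)
    where
    minus-suc : ∀ (a i : ℤ) → a - (+ 1 + i) - + 1 ≡ a - i - + 1 - + 1
    minus-suc = solve-∀

  -- Summing the initial window: -i (k - i times), then 2k - i, then k - i - 1
  -- (i - 1 times), for a total of k - i + 1.
  lucasInit-sum : ∀ i' → suc i' ≤ k → sumGo 0 k (λ d → lucasInit (suc i') (suc i' +ℕ d)) ≡ + k - + suc i' + + 1
  lucasInit-sum i' i≤k = begin
    sumGo 0 k h                                        ≡⟨ cong (λ c → sumGo 0 c h) (sym r+i≡k) ⟩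
    sumGo 0 (r +ℕ i) h                                 ≡⟨ sumGo-split 0 r i h ⟩
    sumGo 0 r h + (h r + sumGo (suc r) i' h)           ≡⟨ cong₂ _+_ before (cong₂ _+_ at after) ⟩
    sumGo 0 r (λ _ → - + i) + (+ k + + k - + i + sumGo (suc r) i' (λ _ → + k - + i - + 1))
      ≡⟨ cong₂ _+_ (sumGo-const 0 r _) (cong (_+_ (+ k + + k - + i)) (sumGo-const (suc r) i' _)) ⟩
    + r * - + i + (+ k + + k - + i + + i' * (+ k - + i - + 1))
      ≡⟨ cong (λ K → + r * - + i + (K + K - + i + + i' * (K - + i - + 1))) (cong +_ (sym r+i≡k)) ⟩
    + r * - + i + (+ (r +ℕ i) + + (r +ℕ i) - + i + + i' * (+ (r +ℕ i) - + i - + 1))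
      ≡⟨ count (+ r) (+ i') ⟩
    + (r +ℕ i) - + i + + 1                              ≡⟨ cong (λ K → + K - + i + + 1) r+i≡k ⟩
    + k - + i + + 1                                     ∎
    where
    i r : ℕ
    i = suc i'
    r = k ∸ i
    h : ℕ → ℤ
    h d = lucasInit i (i +ℕ d)
    r+i≡k : r +ℕ i ≡ k
    r+i≡k = ℕP.m∸n+n≡m i≤k
    i+r≡k : i +ℕ r ≡ k
    i+r≡k = trans (ℕP.+-comm i r) r+i≡k
    before : sumGo 0 r h ≡ sumGo 0 r (λ _ → - + i)
    before = sumGo-cong 0 r (λ d _ d<r →
      lucasInit-below i (i +ℕ d) (subst (i +ℕ d <_) i+r≡k (ℕP.+-monoʳ-< i d<r)))
    at : h r ≡ + k + + k - + i
    at = lucasInit-at i (i +ℕ r) i+r≡k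
    after : sumGo (suc r) i' h ≡ sumGo (suc r) i' (λ _ → + k - + i - + 1)
    after = sumGo-cong (suc r) i' (λ d r<d _ →
      lucasInit-above i (i +ℕ d) (subst (_< i +ℕ d) i+r≡k (ℕP.+-monoʳ-< i r<d)))
    count : ∀ (r i' : ℤ) →
      r * - (+ 1 + i')
        + ((r + (+ 1 + i')) + (r + (+ 1 + i')) - (+ 1 + i') + i' * ((r + (+ 1 + i')) - (+ 1 + i') - + 1))
      ≡ (r + (+ 1 + i')) - (+ 1 + i') + + 1
    count = solve-∀

  lucas-at-one : ∀ i' → suc i' ≤ k → l (suc i') (+ 1) ≡ + k - + suc i' + + 1
  lucas-at-one i' i≤k = begin
    l i (+ 1)                                  ≡⟨ lucas-rec i (s≤s z≤n) i≤k (+ 1) ⟩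
    sumGo 1 k (λ j → l i (+ 1 - + j))          ≡⟨ sumGo-shift 0 k (λ j → l i (+ 1 - + j)) ⟩
    sumGo 0 k (λ d → l i (+ 1 - + suc d))      ≡⟨ sumGo-cong 0 k (λ d _ d<k →
                                                    trans (cong (l i) (back (+ d))) (lucas-initial i d (s≤s z≤n) i≤k d<k)) ⟩
    sumGo 0 k (λ d → lucasInit i (i +ℕ d))     ≡⟨ lucasInit-sum i' i≤k ⟩
    + k - + i + + 1                            ∎
    where
    i : ℕ
    i = suc i'
    back : ∀ (d : ℤ) → + 1 - (+ 1 + d) ≡ - d
    back = solve-∀

  -- l^0 := 0 makes the step relation below uniform in i.
  lucasOrZero : ℕ → ℤ → ℤ
  lucasOrZero zero    p = + 0
  lucasOrZero (suc i) p = l (suc i) p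

  lucasOrZero-rec : ∀ i → i ≤ k → Rec k (lucasOrZero i)
  lucasOrZero-rec zero    _   p = sym (sumGo-vanish 1 k (λ _ _ _ → refl))
  lucasOrZero-rec (suc i) i≤k = lucas-rec (suc i) (s≤s z≤n) i≤k

  lucasOrZero-initial : ∀ i d → i ≤ k → d < k → lucasOrZero i (- + d) ≡ lucasInit i (i +ℕ d)
  lucasOrZero-initial zero    d _   d<k = sym (lucasInit-below 0 d d<k)
  lucasOrZero-initial (suc i) d i≤k d<k = lucas-initial (suc i) d (s≤s z≤n) i≤k d<k

  lucas-step : ∀ i → suc i < k → ∀ p → l (suc i) (p + + 1) ≡ lucasOrZero i p + l k p
  lucas-step i i+1<k =
    uniqueness k' (Rec-shift k (l (suc i)) (lucas-rec (suc i) (s≤s z≤n) (ℕP.<⇒≤ i+1<k)) (+ 1))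
      (Rec-+ k (lucasOrZero i) (l k) (lucasOrZero-rec i i≤k) (lucas-rec k (s≤s z≤n) ℕP.≤-refl))
      initial
    where
    i≤k : i ≤ k
    i≤k = ℕP.<⇒≤ (ℕP.<⇒≤ i+1<k)
    initial : ∀ d → d < k → l (suc i) (- + d + + 1) ≡ lucasOrZero i (- + d) + l k (- + d)
    initial zero    _ = begin
      l (suc i) (+ 1)                  ≡⟨ lucas-at-one i (ℕP.<⇒≤ i+1<k) ⟩
      + k - + suc i + + 1              ≡⟨ rearrange (+ i) (+ k) ⟩
      - + i + (+ k + + k - + k)        ≡⟨ sym (cong₂ _+_
          (trans (lucasOrZero-initial i 0 i≤k (s≤s z≤n))
                 (lucasInit-below i (i +ℕ 0) (subst (_< k) (sym (ℕP.+-identityʳ i)) (ℕP.<⇒≤ i+1<k))))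
          (trans (lucas-initial k 0 (s≤s z≤n) ℕP.≤-refl (s≤s z≤n))
                 (lucasInit-at k (k +ℕ 0) (ℕP.+-identityʳ k)))) ⟩
      lucasOrZero i (+ 0) + l k (+ 0) ∎
      where
      rearrange : ∀ (i k : ℤ) → k - (+ 1 + i) + + 1 ≡ - i + (k + k - k)
      rearrange = solve-∀
    initial (suc d) d+1<k = begin
      l (suc i) (- + suc d + + 1)                        ≡⟨ cong (l (suc i)) (back (+ d)) ⟩
      l (suc i) (- + d)                                  ≡⟨ lucas-initial (suc i) d (s≤s z≤n) (ℕP.<⇒≤ i+1<k) d<k ⟩
      lucasInit (suc i) (suc i +ℕ d)                     ≡⟨ lucasInit-pred i (suc i +ℕ d) ⟩
      lucasInit i (suc i +ℕ d) - + 1                     ≡⟨ cong₂ _+_ (cong (lucasInit i) (sym (ℕP.+-suc i d)))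
                                                                      (sym (minus-one (+ k))) ⟩
      lucasInit i (i +ℕ suc d) + (+ k - + k - + 1)      ≡⟨ sym (cong₂ _+_
          (lucasOrZero-initial i (suc d) i≤k d+1<k)
          (trans (lucas-initial k (suc d) (s≤s z≤n) ℕP.≤-refl d+1<k)
                 (lucasInit-above k (k +ℕ suc d) (ℕP.m<m+n k (s≤s z≤n))))) ⟩
      lucasOrZero i (- + suc d) + l k (- + suc d)       ∎
      where
      d<k : d < k
      d<k = ℕP.<⇒≤ d+1<k
      back : ∀ (d : ℤ) → - (+ 1 + d) + + 1 ≡ - d
      back = solve-∀
      minus-one : ∀ (k : ℤ) → k - k - + 1 ≡ - + 1
      minus-one = solve-∀

  lucas-as-sum : ∀ i → i < k → ∀ p → lucasOrZero i p ≡ sumGo 1 i (λ t → l k (p - + t))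
  lucas-as-sum zero    _     p = refl
  lucas-as-sum (suc i) i+1<k p = begin
    l (suc i) p                                              ≡⟨ cong (l (suc i)) (sym (back-forth p)) ⟩
    l (suc i) (p - + 1 + + 1)                                ≡⟨ lucas-step i i+1<k (p - + 1) ⟩
    lucasOrZero i (p - + 1) + l k (p - + 1)                  ≡⟨ cong (_+ l k (p - + 1))
                                                                  (lucas-as-sum i (ℕP.<⇒≤ i+1<k) (p - + 1)) ⟩
    sumGo 1 i (λ t → l k (p - + 1 - + t)) + l k (p - + 1)    ≡⟨ ℤP.+-comm _ (l k (p - + 1)) ⟩
    l k (p - + 1) + sumGo 1 i (λ t → l k (p - + 1 - + t))    ≡⟨ cong (_+_ (l k (p - + 1)))
        (trans (sumGo-cong 1 i (λ t _ _ → cong (l k) (combine p (+ t))))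
               (sym (sumGo-shift 1 i (λ t → l k (p - + t))))) ⟩
    l k (p - + 1) + sumGo 2 i (λ t → l k (p - + t))          ∎
    where
    back-forth : ∀ (p : ℤ) → p - + 1 + + 1 ≡ p
    back-forth = solve-∀
    combine : ∀ (p t : ℤ) → p - + 1 - t ≡ p - (+ 1 + t)
    combine = solve-∀

  lucas-addition : ∀ i' → suc i' < k → ∀ m n →
    l (suc i') (n + m) ≡ sumGo 1 (k +ℕ i') (λ j → l k (m - + j) * window (suc i') j (truncate k (λ s → f s n)))
  lucas-addition i' i<k m n = begin
    l (suc i') (n + m)                               ≡⟨ lucas-as-sum (suc i') i<k (n + m) ⟩
    sumGo 1 (suc i') (λ t → l k (n + m - + t))       ≡⟨ sumGo-shift 0 (suc i') (λ t → l k (n + m - + t)) ⟩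
    sumGo 0 (suc i') (λ t → l k (n + m - + suc t))   ≡⟨ sumGo-cong 0 (suc i') (λ t _ _ → row t) ⟩
    sumGo 0 (suc i') (λ t → sumGo 1 k (λ s → l k (m - + (t +ℕ s)) * g s))
      ≡⟨ convolution k g (truncate-> k F) i' (λ j → l k (m - + j)) ⟩
    sumGo 1 (k +ℕ i') (λ j → l k (m - + j) * window (suc i') j g) ∎
    where
    F g : ℕ → ℤ
    F s = f s n
    g = truncate k F
    regroup : ∀ (n m t : ℤ) → n + m - (+ 1 + t) ≡ n + (m - (+ 1 + t))
    regroup = solve-∀
    reindex : ∀ (m t s : ℤ) → m - (+ 1 + t) + + 1 - s ≡ m - (t + s)
    reindex = solve-∀
    row : ∀ t → l k (n + m - + suc t) ≡ sumGo 1 k (λ s → l k (m - + (t +ℕ s)) * g s)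
    row t = begin
      l k (n + m - + suc t)                                    ≡⟨ cong (l k) (regroup n m (+ t)) ⟩
      l k (n + (m - + suc t))                                  ≡⟨ fib-expansion (l k) (lucas-rec k (s≤s z≤n) ℕP.≤-refl)
                                                                                  (m - + suc t) n ⟩
      sumGo 1 k (λ s → l k (m - + suc t + + 1 - + s) * f s n)  ≡⟨ sumGo-cong 1 k (λ s _ s<e →
          cong₂ _*_ (cong (l k) (reindex m (+ t) (+ s))) (sym (truncate-≤ k F s (ℕP.≤-pred s<e)))) ⟩
      sumGo 1 k (λ s → l k (m - + (t +ℕ s)) * g s)             ∎

theorem2p12 : (k : ℕ) → 2 ≤ k → (f l : ℕ → ℤ → ℤ) → IsGenFib k f → IsGenLucas k l →
    (m n : ℤ) (i : ℕ) → 1 ≤ i → i ≤ k ∸ 1 →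
    l i (n + m) ≡
      Σ[ 1 ⋯ i ] (λ j → l k (m - + j) * Σ[ 1 ⋯ j ] (λ s → f s n))
      + Σ[ i +ℕ 1 ⋯ k ] (λ j → l k (m - + j) * Σ[ j ∸ i +ℕ 1 ⋯ j ] (λ s → f s n))
      + Σ[ k +ℕ 1 ⋯ k +ℕ i ∸ 1 ] (λ j → l k (m - + j) * Σ[ j ∸ i +ℕ 1 ⋯ k ] (λ s → f s n))
theorem2p12 zero     ()
theorem2p12 (suc k') _ f l hf hl m n zero     ()
theorem2p12 (suc k') _ f l hf hl m n (suc i') (s≤s z≤n) i<k' =
  trans (lucas-addition i' (s≤s i<k') m n)
        (sym (three-ranges (suc k') i' (λ j → l (suc k') (m - + j)) (λ s → f s n) (ℕP.m≤n⇒m≤1+n i<k')))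
  where open GeneralizedFibonacciLucas k' f l hf hl
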